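{- Let $f,g\in\mathbf{Q}[t]$ be coprime polynomials of degrees $r$ and $s$, at least one positive; write $\max(r/4,s/6)=n/m$ with $n,m$ coprime positive integers, and assume $n=1$ or $m=1$. For $X\ge1$ let $S(X)$ be the set of $(A,B)\in\mathbf{Z}^2$ with $4A^3+27B^2\ne0$, $\gcd(A^3,B^2)$ not divisible by $d^{12}$ for any integer $d>1$, $|A|<X^{1/3}$, $|B|<X^{1/2}$, and $A=u^4f(t)$, $B=u^6g(t)$ for some $u,t\in\mathbf{Q}$; let $S_1(X)$ be the set of $(u,t)\in\mathbf{Q}^2$ with $(u^4f(t),u^6g(t))\in S(X)$. Let $Q$ be a finite set of non-zero rationals such that every $(u,t)\in S_1(X)$ (for every $X$) can be written as $t=a/b^m$, $u=qb^n$ with $a,b\in\mathbf{Z}$, $b>0$, $\gcd(a,b^m)$ not divisible by any $m$th power $e^m$ with $e>1$, and $q\in Q$. Then there are constants $K,K'>0$ such that for all $X\ge1$ and all $(u,t)\in S_1(X)$, writing $t=a/b^m$ in this way, $|a|\le KX^{m/12n}$ and $|b|\le K'X^{1/12n}$.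
   Formalization: The parameter X ranges over the rationals X ≥ 1 rather than over all real numbers. -}

module Defs where

open import Data.Nat as ℕ using (ℕ; zero; suc; _∸_)
open import Data.Nat.Divisibility as ℕD using ()
open import Data.Nat.GCD using (gcd)
open import Data.Integer as ℤ using (ℤ; +_)
open import Data.Rational as ℚ using (ℚ; 0ℚ; 1ℚ; _+_; _*_)
open import Data.List using (List; []; _∷_; foldr)
open import Data.Product using (∃; ∃-syntax; _×_)
open import Relation.Binary.PropositionalEquality using (_≡_; _≢_)
open import Relation.Nullary using (¬_)

_^ℚ_ : ℚ → ℕ → ℚ
x ^ℚ zero  = 1ℚ
x ^ℚ suc k = x * (x ^ℚ k)

ℤ→ℚ : ℤ → ℚ
ℤ→ℚ z = z ℚ./ 1

-- Polynomials over ℚ: coefficient lists, lowest degree first.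

Poly : Set
Poly = List ℚ

coeff : Poly → ℕ → ℚ
coeff []       _       = 0ℚ
coeff (c ∷ cs) zero    = c
coeff (c ∷ cs) (suc k) = coeff cs k

eval : Poly → ℚ → ℚ
eval p t = foldr (λ c acc → c + t * acc) 0ℚ p

HasDegree : Poly → ℕ → Set
HasDegree p d = coeff p d ≢ 0ℚ × (∀ k → d ℕ.< k → coeff p k ≡ 0ℚ)

-- sum_{i = 0}^{j} p_i h_{k - i}, used with j = k: the k-th coefficient of p·h
convUpTo : Poly → Poly → ℕ → ℕ → ℚ
convUpTo p h k zero    = coeff p 0 * coeff h k
convUpTo p h k (suc j) = convUpTo p h k j + coeff p (suc j) * coeff h (k ∸ suc j)

_∣ₚ_ : Poly → Poly → Set
p ∣ₚ f = ∃[ h ] (∀ k → coeff f k ≡ convUpTo p h k k)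

CoprimePoly : Poly → Poly → Set
CoprimePoly f g = ∀ p → p ∣ₚ f → p ∣ₚ g → HasDegree p 0

TwelfthPowerFree : ℤ → ℤ → Set
TwelfthPowerFree A B =
  ∀ (d : ℕ) → 1 ℕ.< d → ¬ ((d ℕ.^ 12) ℕD.∣ gcd (ℤ.∣ A ∣ ℕ.^ 3) (ℤ.∣ B ∣ ℕ.^ 2))

-- (A,B) ∈ S(X)   (the condition "A = u⁴f(t), B = u⁶g(t) for some u,t" is
-- added in InS₁; |A| < X^{1/3} and |B| < X^{1/2} are written as |A|³ < X, B² < X)
InS : ℚ → ℤ → ℤ → Set
InS X A B =
  (+ 4 ℤ.* A ℤ.^ 3 ℤ.+ + 27 ℤ.* B ℤ.^ 2 ≢ + 0)
  × TwelfthPowerFree A B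
  × (ℤ→ℚ (+ (ℤ.∣ A ∣ ℕ.^ 3)) ℚ.< X)
  × (ℤ→ℚ (+ (ℤ.∣ B ∣ ℕ.^ 2)) ℚ.< X)

InS₁ : Poly → Poly → ℚ → ℚ → ℚ → Set
InS₁ f g X u t =
  ∃[ A ] ∃[ B ] ( (u ^ℚ 4) * eval f t ≡ ℤ→ℚ A
                × (u ^ℚ 6) * eval g t ≡ ℤ→ℚ B
                × InS X A B)

MthPowerFreeGcd : ℕ → ℤ → ℕ → Set
MthPowerFreeGcd m a b = ∀ (e : ℕ) → 1 ℕ.< e → ¬ ((e ℕ.^ m) ℕD.∣ gcd ℤ.∣ a ∣ (b ℕ.^ m))

Rep : List ℚ → ℕ → ℕ → ℚ → ℚ → ℤ → ℕ → ℚ → Set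
Rep Q n m u t a b q =
  (0 ℕ.< b)
  × (t * ℤ→ℚ (+ (b ℕ.^ m)) ≡ ℤ→ℚ a)
  × (u ≡ q * ℤ→ℚ (+ (b ℕ.^ n)))
  × MthPowerFreeGcd m a b
  × (q Data.List.Membership.Propositional.∈ Q)
  where import Data.List.Membership.Propositional

-- y ≤ K · X^{p/q} for y, K, X ≥ 0, written without real roots as y^q ≤ K^q · X^p
LeRootBound : ℚ → ℚ → ℚ → ℕ → ℕ → Set
LeRootBound y K X p q = (y ^ℚ q) ℚ.≤ (K ^ℚ q) * (X ^ℚ p)

module Submission where

-- For a representation t = a/bᵐ, u = q·bⁿ put β = b and α = |a|, so that
-- α = |t|·βᵐ and βⁿ ≤ ι·|u| for a constant ι depending only on Q.  On
-- S₁(X) the integers A = u⁴f(t), B = u⁶g(t) satisfy |A|³ < X and B² < X.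
--   * Near t = 0 (|t| ≤ T): since f and g are coprime, Bézout's identity
--     forces |f(t)| ≥ 1/w or |g(t)| ≥ 1/w, so |u|¹² ≤ w³|A|³ or w²B² and
--     β^(12n) ≤ C·X; then α^(12n) = |t|^(12n)·(β^(12n))ᵐ ≤ C′·Xᵐ.
--   * Far from 0 (|t| ≥ T): the polynomial p ∈ {f, g} attaining
--     max(r/4, s/6) = n/m, of degree d and weight k ∈ {4, 6} (d·m = k·n),
--     satisfies |t|ᵈ ≤ κ·|p(t)|, hence αᵈ = |t|ᵈ·(βⁿ)ᵏ ≤ C·|u|ᵏ|p(t)|, which
--     is C·|A| or C·|B|; so α^(12n) ≤ C′·Xᵐ, and βᵐ ≤ α gives β^(12n) ≤ C″·X.

open import Defs
open import Level using (0ℓ)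
open import Data.Nat as ℕ using (ℕ; zero; suc; _∸_; _⊔_)
import Data.Nat.Properties as ℕP
import Data.Nat.Tactic.RingSolver as ℕ-Solver
import Data.Nat.Coprimality as Coprimality
open Coprimality using (Coprime)
open import Data.Integer as ℤ using (ℤ; +_)
import Data.Integer.Properties as ℤP
open import Data.Rational as ℚ using (ℚ; 0ℚ; 1ℚ; _+_; _*_; -_; _-_; _≤_; _<_; ∣_∣; mkℚ; nonNegative; positive)
open import Data.Rational.Properties
open import Data.List using (List; []; _∷_; map)
open import Data.List.Relation.Unary.All using (All; []; _∷_)
open import Data.List.Relation.Unary.Any using (here; there)
open import Data.List.Membership.Propositional using (_∈_)
open import Data.Maybe using (Maybe; just; nothing)
open import Data.Product using (∃; ∃-syntax; _×_; _,_; proj₁; proj₂)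
open import Data.Sum using (_⊎_; inj₁; inj₂)
open import Data.Empty using (⊥-elim)
open import Relation.Nullary using (yes; no)
open import Relation.Binary.PropositionalEquality
open import Algebra.Bundles using (CommutativeRing)
import Algebra.Properties.CommutativeSemiring.Exp as SemiringExp
open import Tactic.RingSolver using (solve-∀)
open import Tactic.RingSolver.Core.AlmostCommutativeRing using (AlmostCommutativeRing; fromCommutativeRing)

open ≤-Reasoning

ℚ-ring : AlmostCommutativeRing 0ℓ 0ℓ
ℚ-ring = fromCommutativeRing +-*-commutativeRing isZero
  where
  isZero : ∀ x → Maybe (0ℚ ≡ x)
  isZero x with 0ℚ ≟ x
  ... | yes 0≡x = just 0≡x
  ... | no _    = nothing

0≤1 : 0ℚ ≤ 1ℚ
0≤1 = nonNegative⁻¹ 1ℚ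

*-≥0 : ∀ {p q} → 0ℚ ≤ p → 0ℚ ≤ q → 0ℚ ≤ p * q
*-≥0 {p} {q} 0≤p 0≤q =
  nonNegative⁻¹ (p * q) {{nonNeg*nonNeg⇒nonNeg p {{nonNegative 0≤p}} q {{nonNegative 0≤q}}}}

+-≥0 : ∀ {p q} → 0ℚ ≤ p → 0ℚ ≤ q → 0ℚ ≤ p + q
+-≥0 = +-mono-≤

*-monoˡ-≤-≥0 : ∀ {r p q} → 0ℚ ≤ r → p ≤ q → r * p ≤ r * q
*-monoˡ-≤-≥0 {r} 0≤r = *-monoˡ-≤-nonNeg r {{nonNegative 0≤r}}

*-monoʳ-≤-≥0 : ∀ {r p q} → 0ℚ ≤ r → p ≤ q → p * r ≤ q * r
*-monoʳ-≤-≥0 {r} 0≤r = *-monoʳ-≤-nonNeg r {{nonNegative 0≤r}}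

*-mono-≤-≥0 : ∀ {p q r s} → 0ℚ ≤ p → 0ℚ ≤ r → p ≤ q → r ≤ s → p * r ≤ q * s
*-mono-≤-≥0 0≤p 0≤r p≤q r≤s =
  ≤-trans (*-monoʳ-≤-≥0 0≤r p≤q) (*-monoˡ-≤-≥0 (≤-trans 0≤p p≤q) r≤s)

p≤p+q : ∀ {p q} → 0ℚ ≤ q → p ≤ p + q
p≤p+q {p} 0≤q = subst (_≤ p + _) (+-identityʳ p) (+-monoʳ-≤ p 0≤q)

p≤q+p : ∀ {p q} → 0ℚ ≤ q → p ≤ q + p
p≤q+p {p} {q} 0≤q = subst (p ≤_) (+-comm p q) (p≤p+q 0≤q)

module Exp = SemiringExp (CommutativeRing.commutativeSemiring +-*-commutativeRing)

^ℚ≡^ : ∀ x k → x ^ℚ k ≡ x Exp.^ k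
^ℚ≡^ x zero    = refl
^ℚ≡^ x (suc k) = cong (x *_) (^ℚ≡^ x k)

^ℚ-distrib-* : ∀ x y k → (x * y) ^ℚ k ≡ x ^ℚ k * y ^ℚ k
^ℚ-distrib-* x y k = begin-equality
  (x * y) ^ℚ k         ≡⟨ ^ℚ≡^ (x * y) k ⟩
  (x * y) Exp.^ k      ≡⟨ Exp.^-distrib-* x y k ⟩
  x Exp.^ k * y Exp.^ k ≡⟨ sym (cong₂ _*_ (^ℚ≡^ x k) (^ℚ≡^ y k)) ⟩
  x ^ℚ k * y ^ℚ k      ∎

^ℚ-assoc : ∀ x i j → (x ^ℚ i) ^ℚ j ≡ x ^ℚ (i ℕ.* j)
^ℚ-assoc x i j = begin-equality
  (x ^ℚ i) ^ℚ j       ≡⟨ ^ℚ≡^ (x ^ℚ i) j ⟩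
  (x ^ℚ i) Exp.^ j    ≡⟨ cong (Exp._^ j) (^ℚ≡^ x i) ⟩
  (x Exp.^ i) Exp.^ j ≡⟨ Exp.^-assocʳ x i j ⟩
  x Exp.^ (i ℕ.* j)   ≡⟨ sym (^ℚ≡^ x (i ℕ.* j)) ⟩
  x ^ℚ (i ℕ.* j)      ∎

^ℚ-abs : ∀ x k → ∣ x ^ℚ k ∣ ≡ ∣ x ∣ ^ℚ k
^ℚ-abs x zero    = refl
^ℚ-abs x (suc k) = trans (∣p*q∣≡∣p∣*∣q∣ x (x ^ℚ k)) (cong (∣ x ∣ *_) (^ℚ-abs x k))

^ℚ-≥0 : ∀ {x} k → 0ℚ ≤ x → 0ℚ ≤ x ^ℚ k
^ℚ-≥0 zero    0≤x = 0≤1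
^ℚ-≥0 (suc k) 0≤x = *-≥0 0≤x (^ℚ-≥0 k 0≤x)

^ℚ-mono-≤ : ∀ {x y} k → 0ℚ ≤ x → x ≤ y → x ^ℚ k ≤ y ^ℚ k
^ℚ-mono-≤ zero    0≤x x≤y = ≤-refl
^ℚ-mono-≤ (suc k) 0≤x x≤y = *-mono-≤-≥0 0≤x (^ℚ-≥0 k 0≤x) x≤y (^ℚ-mono-≤ k 0≤x x≤y)

^ℚ-mono-< : ∀ {x y} k → 0ℚ ≤ x → x < y → x ^ℚ suc k < y ^ℚ suc k
^ℚ-mono-< {x} {y} zero    0≤x x<y = subst₂ _<_ (sym (*-identityʳ x)) (sym (*-identityʳ y)) x<y
^ℚ-mono-< {x} {y} (suc k) 0≤x x<y = begin-strict
  x * x ^ℚ suc k ≤⟨ *-monoʳ-≤-≥0 (^ℚ-≥0 (suc k) 0≤x) (<⇒≤ x<y) ⟩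
  y * x ^ℚ suc k <⟨ *-monoʳ-<-pos y {{positive (≤-<-trans 0≤x x<y)}} (^ℚ-mono-< k 0≤x x<y) ⟩
  y * y ^ℚ suc k ∎

^ℚ-≥1 : ∀ {x} k → 1ℚ ≤ x → 1ℚ ≤ x ^ℚ k
^ℚ-≥1 zero    1≤x = ≤-refl
^ℚ-≥1 (suc k) 1≤x = *-mono-≤-≥0 0≤1 0≤1 1≤x (^ℚ-≥1 k 1≤x)

p≤p^k : ∀ {x} k → 0 ℕ.< k → 1ℚ ≤ x → x ≤ x ^ℚ k
p≤p^k {x} (suc k) _ 1≤x = begin
  x          ≡⟨ sym (*-identityʳ x) ⟩
  x * 1ℚ     ≤⟨ *-monoˡ-≤-≥0 (≤-trans 0≤1 1≤x) (^ℚ-≥1 k 1≤x) ⟩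
  x * x ^ℚ k ∎

^ℚ-cancel-≤ : ∀ {x y} k → 0 ℕ.< k → 0ℚ ≤ y → x ^ℚ k ≤ y ^ℚ k → x ≤ y
^ℚ-cancel-≤ {x} {y} (suc k) _ 0≤y xᵏ≤yᵏ with x ≤? y
... | yes x≤y = x≤y
... | no  x≰y = ⊥-elim (<-irrefl refl (<-≤-trans (^ℚ-mono-< k 0≤y (≰⇒> x≰y)) xᵏ≤yᵏ))

ℤ→ℚ≡mkℚ : ∀ z → ℤ→ℚ z ≡ mkℚ z 0 (Coprimality.sym (Coprimality.1-coprimeTo ℤ.∣ z ∣))
ℤ→ℚ≡mkℚ z = ↥p/↧p≡p (mkℚ z 0 _)

ℤ→ℚ-* : ∀ x y → ℤ→ℚ (+ (x ℕ.* y)) ≡ ℤ→ℚ (+ x) * ℤ→ℚ (+ y)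
ℤ→ℚ-* x y = trans (cong (ℚ._/ 1) (sym (ℤP.+◃n≡+n (x ℕ.* y))))
                  (sym (cong₂ _*_ (ℤ→ℚ≡mkℚ (+ x)) (ℤ→ℚ≡mkℚ (+ y))))

ℤ→ℚ-^ : ∀ x k → ℤ→ℚ (+ (x ℕ.^ k)) ≡ ℤ→ℚ (+ x) ^ℚ k
ℤ→ℚ-^ x zero    = refl
ℤ→ℚ-^ x (suc k) = trans (ℤ→ℚ-* x (x ℕ.^ k)) (cong (ℤ→ℚ (+ x) *_) (ℤ→ℚ-^ x k))

∣ℤ→ℚ∣ : ∀ z → ∣ ℤ→ℚ z ∣ ≡ ℤ→ℚ (+ ℤ.∣ z ∣)
∣ℤ→ℚ∣ z rewrite ℤ→ℚ≡mkℚ z | ℤ→ℚ≡mkℚ (+ ℤ.∣ z ∣) = refl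

ℤ→ℚ-≥0 : ∀ n → 0ℚ ≤ ℤ→ℚ (+ n)
ℤ→ℚ-≥0 n = subst (0ℚ ≤_) (∣ℤ→ℚ∣ (+ n)) (0≤∣p∣ (ℤ→ℚ (+ n)))

infixl 6 _⊕_
_⊕_ : Poly → Poly → Poly
[]      ⊕ q       = q
(x ∷ p) ⊕ []      = x ∷ p
(x ∷ p) ⊕ (y ∷ q) = (x + y) ∷ (p ⊕ q)

scale : ℚ → Poly → Poly
scale c = map (c *_)

shift : ℕ → Poly → Poly
shift zero    p = p
shift (suc j) p = 0ℚ ∷ shift j p

coeff-⊕ : ∀ p q k → coeff (p ⊕ q) k ≡ coeff p k + coeff q k
coeff-⊕ []      q       k       = sym (+-identityˡ _)
coeff-⊕ (x ∷ p) []      k       = sym (+-identityʳ _)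
coeff-⊕ (x ∷ p) (y ∷ q) zero    = refl
coeff-⊕ (x ∷ p) (y ∷ q) (suc k) = coeff-⊕ p q k

coeff-scale : ∀ c p k → coeff (scale c p) k ≡ c * coeff p k
coeff-scale c []      k       = sym (*-zeroʳ c)
coeff-scale c (x ∷ p) zero    = refl
coeff-scale c (x ∷ p) (suc k) = coeff-scale c p k

coeff-shift : ∀ j p k → j ℕ.≤ k → coeff (shift j p) k ≡ coeff p (k ∸ j)
coeff-shift zero    p k       _         = refl
coeff-shift (suc j) p (suc k) (ℕ.s≤s j≤k) = coeff-shift j p k j≤k

eval-⊕ : ∀ p q t → eval (p ⊕ q) t ≡ eval p t + eval q t
eval-⊕ []      q       t = sym (+-identityˡ _)
eval-⊕ (x ∷ p) []      t = sym (+-identityʳ _)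
eval-⊕ (x ∷ p) (y ∷ q) t rewrite eval-⊕ p q t = ring x y t (eval p t) (eval q t)
  where
  ring : ∀ x y t a b → x + y + t * (a + b) ≡ x + t * a + (y + t * b)
  ring = solve-∀ ℚ-ring

eval-scale : ∀ c p t → eval (scale c p) t ≡ c * eval p t
eval-scale c []      t = sym (*-zeroʳ c)
eval-scale c (x ∷ p) t rewrite eval-scale c p t = ring c x t (eval p t)
  where
  ring : ∀ c x t a → c * x + t * (c * a) ≡ c * (x + t * a)
  ring = solve-∀ ℚ-ring

eval-shift : ∀ j p t → eval (shift j p) t ≡ t ^ℚ j * eval p t
eval-shift zero    p t = sym (*-identityˡ _)
eval-shift (suc j) p t rewrite eval-shift j p t = ring t (t ^ℚ j) (eval p t)
  where
  ring : ∀ t a b → 0ℚ + t * (a * b) ≡ t * a * b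
  ring = solve-∀ ℚ-ring

eval-≡0 : ∀ p t → (∀ k → coeff p k ≡ 0ℚ) → eval p t ≡ 0ℚ
eval-≡0 []      t _  = refl
eval-≡0 (x ∷ p) t p≡0 rewrite p≡0 0 | eval-≡0 p t (λ k → p≡0 (suc k)) =
  trans (+-identityˡ _) (*-zeroʳ t)

eval-const : ∀ p t → HasDegree p 0 → eval p t ≡ coeff p 0
eval-const []      t (c≢0 , _)   = ⊥-elim (c≢0 refl)
eval-const (c ∷ p) t (_ , higher) rewrite eval-≡0 p t (λ k → higher (suc k) (ℕ.s≤s ℕ.z≤n)) =
  trans (cong (_+_ c) (*-zeroʳ t)) (+-identityʳ c)

-- This product is linear in h, compatible with multiplication by t and
-- has 0 and 1 as zero and unit, so divisibility by a fixed p is closed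
-- under the operations used by Euclid's algorithm.

∸-suc : ∀ {j k} → j ℕ.< k → k ∸ j ≡ suc (k ∸ suc j)
∸-suc {zero}  {suc k} _           = refl
∸-suc {suc j} {suc k} (ℕ.s≤s j<k) = ∸-suc j<k

conv-⊕ : ∀ p h₁ h₂ k j → convUpTo p (h₁ ⊕ h₂) k j ≡ convUpTo p h₁ k j + convUpTo p h₂ k j
conv-⊕ p h₁ h₂ k zero rewrite coeff-⊕ h₁ h₂ k = *-distribˡ-+ (coeff p 0) _ _
conv-⊕ p h₁ h₂ k (suc j) rewrite conv-⊕ p h₁ h₂ k j | coeff-⊕ h₁ h₂ (k ∸ suc j) =
  ring (convUpTo p h₁ k j) (convUpTo p h₂ k j) (coeff p (suc j)) (coeff h₁ (k ∸ suc j)) (coeff h₂ (k ∸ suc j))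
  where
  ring : ∀ a b c x y → a + b + c * (x + y) ≡ a + c * x + (b + c * y)
  ring = solve-∀ ℚ-ring

conv-scale : ∀ p c h k j → convUpTo p (scale c h) k j ≡ c * convUpTo p h k j
conv-scale p c h k zero rewrite coeff-scale c h k = ring (coeff p 0) c (coeff h k)
  where
  ring : ∀ a c x → a * (c * x) ≡ c * (a * x)
  ring = solve-∀ ℚ-ring
conv-scale p c h k (suc j) rewrite conv-scale p c h k j | coeff-scale c h (k ∸ suc j) =
  ring (convUpTo p h k j) c (coeff p (suc j)) (coeff h (k ∸ suc j))
  where
  ring : ∀ a c e x → c * a + e * (c * x) ≡ c * (a + e * x)
  ring = solve-∀ ℚ-ring

conv-shift : ∀ p h k j → j ℕ.≤ k → convUpTo p (shift 1 h) (suc k) j ≡ convUpTo p h k j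
conv-shift p h k zero    _   = refl
conv-shift p h k (suc j) j<k rewrite conv-shift p h k j (ℕP.<⇒≤ j<k) | ∸-suc j<k = refl

conv-shift-top : ∀ p h k → convUpTo p (shift 1 h) (suc k) (suc k) ≡ convUpTo p h k k
conv-shift-top p h k rewrite conv-shift p h k k ℕP.≤-refl | ℕP.n∸n≡0 k =
  trans (cong (_+_ (convUpTo p h k k)) (*-zeroʳ (coeff p (suc k)))) (+-identityʳ _)

conv-[] : ∀ p k j → convUpTo p [] k j ≡ 0ℚ
conv-[] p k zero    = *-zeroʳ (coeff p 0)
conv-[] p k (suc j) rewrite conv-[] p k j =
  trans (+-identityˡ (coeff p (suc j) * 0ℚ)) (*-zeroʳ (coeff p (suc j)))

conv-one-below : ∀ p k j → j ℕ.< k → convUpTo p (1ℚ ∷ []) k j ≡ 0ℚ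
conv-one-below p (suc k) zero    _   = *-zeroʳ (coeff p 0)
conv-one-below p k       (suc j) j<k rewrite conv-one-below p k j (ℕP.<-trans ℕP.≤-refl j<k) | ∸-suc j<k =
  trans (+-identityˡ (coeff p (suc j) * 0ℚ)) (*-zeroʳ (coeff p (suc j)))

conv-one : ∀ p k → convUpTo p (1ℚ ∷ []) k k ≡ coeff p k
conv-one p zero    = *-identityʳ _
conv-one p (suc k) rewrite conv-one-below p (suc k) k ℕP.≤-refl | ℕP.n∸n≡0 k =
  trans (+-identityˡ _) (*-identityʳ _)

∣ₚ-⊕ : ∀ {d p q} → d ∣ₚ p → d ∣ₚ q → d ∣ₚ (p ⊕ q)
∣ₚ-⊕ {d} {p} {q} (h₁ , p≡dh₁) (h₂ , q≡dh₂) = h₁ ⊕ h₂ , λ k →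
  trans (coeff-⊕ p q k) (trans (cong₂ _+_ (p≡dh₁ k) (q≡dh₂ k)) (sym (conv-⊕ d h₁ h₂ k k)))

∣ₚ-scale : ∀ {d p} c → d ∣ₚ p → d ∣ₚ scale c p
∣ₚ-scale {d} {p} c (h , p≡dh) = scale c h , λ k →
  trans (coeff-scale c p k) (trans (cong (c *_) (p≡dh k)) (sym (conv-scale d c h k k)))

∣ₚ-shift : ∀ {d p} j → d ∣ₚ p → d ∣ₚ shift j p
∣ₚ-shift         zero    d∣p = d∣p
∣ₚ-shift {d} {p} (suc j) d∣p with ∣ₚ-shift j d∣p
... | h , p≡dh = shift 1 h , λ where
  zero    → sym (*-zeroʳ (coeff d 0))
  (suc k) → trans (p≡dh k) (sym (conv-shift-top d h k))

∣ₚ-refl : ∀ d → d ∣ₚ d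
∣ₚ-refl d = 1ℚ ∷ [] , λ k → sym (conv-one d k)

∣ₚ-≡0 : ∀ d p → (∀ k → coeff p k ≡ 0ℚ) → d ∣ₚ p
∣ₚ-≡0 d p p≡0 = [] , λ k → trans (p≡0 k) (sym (conv-[] d k k))

∣ₚ-resp : ∀ {d p q} → (∀ k → coeff p k ≡ coeff q k) → d ∣ₚ p → d ∣ₚ q
∣ₚ-resp p≡q (h , p≡dh) = h , λ k → trans (sym (p≡q k)) (p≡dh k)

eval-step : ∀ a b c j t → eval (a ⊕ scale c (shift j b)) t ≡ eval a t + c * (t ^ℚ j * eval b t)
eval-step a b c j t =
  trans (eval-⊕ a (scale c (shift j b)) t)
        (cong (_+_ (eval a t)) (trans (eval-scale c (shift j b) t) (cong (c *_) (eval-shift j b t))))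

∣ₚ-unstep : ∀ {d} a b c j → d ∣ₚ (a ⊕ scale c (shift j b)) → d ∣ₚ b → d ∣ₚ a
∣ₚ-unstep {d} a b c j d∣step d∣b =
  ∣ₚ-resp {p = a ⊕ scale c (shift j b) ⊕ scale (- c) (shift j b)} {q = a} undo
    (∣ₚ-⊕ {p = a ⊕ scale c (shift j b)} {q = scale (- c) (shift j b)} d∣step
                      (∣ₚ-scale {p = shift j b} (- c) (∣ₚ-shift {p = b} j d∣b)))
  where
  undo : ∀ k → coeff (a ⊕ scale c (shift j b) ⊕ scale (- c) (shift j b)) k ≡ coeff a k
  undo k rewrite coeff-⊕ (a ⊕ scale c (shift j b)) (scale (- c) (shift j b)) k
               | coeff-⊕ a (scale c (shift j b)) k
               | coeff-scale c (shift j b) k | coeff-scale (- c) (shift j b) k =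
    ring (coeff a k) c (coeff (shift j b) k)
    where
    ring : ∀ x c y → x + c * y + (- c) * y ≡ x
    ring = solve-∀ ℚ-ring

leadRatio : (a b : Poly) (da db : ℕ) → coeff b db ≢ 0ℚ → ℚ
leadRatio a b da db lc≢0 = - (coeff a da * (ℚ.1/ coeff b db) {{ℚ.≢-nonZero lc≢0}})

reduceBy : (a b : Poly) (da db : ℕ) → coeff b db ≢ 0ℚ → Poly
reduceBy a b da db lc≢0 = a ⊕ scale (leadRatio a b da db lc≢0) (shift (da ∸ db) b)

reduceBy-lowersDegree : ∀ a b {da db} → HasDegree a da → (hb : HasDegree b db) → db ℕ.≤ da
                      → ∀ k → da ℕ.≤ k → coeff (reduceBy a b da db (proj₁ hb)) k ≡ 0ℚ
reduceBy-lowersDegree a b {da} {db} (_ , a-top) (lc≢0 , b-top) db≤da k da≤k = begin-equality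
  coeff (a ⊕ scale (- c) (shift j b)) k     ≡⟨ coeff-⊕ a _ k ⟩
  coeff a k + coeff (scale (- c) (shift j b)) k
    ≡⟨ cong (_+_ (coeff a k)) (trans (coeff-scale (- c) (shift j b) k)
                                     (cong ((- c) *_) (coeff-shift j b k (ℕP.≤-trans (ℕP.m∸n≤m da db) da≤k)))) ⟩
  coeff a k + (- c) * coeff b (k ∸ j)       ≡⟨ vanish (ℕP.m≤n⇒m<n∨m≡n da≤k) ⟩
  0ℚ                                        ∎
  where
  instance
    lc-nonZero : ℚ.NonZero (coeff b db)
    lc-nonZero = ℚ.≢-nonZero lc≢0
  c : ℚ
  c = coeff a da * ℚ.1/ coeff b db
  j : ℕ
  j = da ∸ db
  shifted-above : da ℕ.< k → db ℕ.< k ∸ j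
  shifted-above da<k = subst (ℕ._< k ∸ j) (ℕP.m∸[m∸n]≡n db≤da) (ℕP.∸-monoˡ-< da<k (ℕP.m∸n≤m da db))
  vanish : da ℕ.< k ⊎ da ≡ k → coeff a k + (- c) * coeff b (k ∸ j) ≡ 0ℚ
  vanish (inj₁ da<k) rewrite a-top k da<k | b-top (k ∸ j) (shifted-above da<k) =
    trans (+-identityˡ _) (*-zeroʳ (- c))
  vanish (inj₂ refl) rewrite ℕP.m∸[m∸n]≡n db≤da = begin-equality
    coeff a da + (- (coeff a da * ℚ.1/ coeff b db)) * coeff b db
      ≡⟨ ring (coeff a da) (ℚ.1/ coeff b db) (coeff b db) ⟩
    coeff a da - coeff a da * (ℚ.1/ coeff b db * coeff b db)
      ≡⟨ cong (λ z → coeff a da - coeff a da * z) (*-inverseˡ (coeff b db)) ⟩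
    coeff a da - coeff a da * 1ℚ
      ≡⟨ ring′ (coeff a da) ⟩
    0ℚ ∎
    where
    ring : ∀ x i y → x + (- (x * i)) * y ≡ x - x * (i * y)
    ring = solve-∀ ℚ-ring
    ring′ : ∀ x → x - x * 1ℚ ≡ 0ℚ
    ring′ = solve-∀ ℚ-ring

degreeBelow : ∀ p d → (∀ k → d ℕ.≤ k → coeff p k ≡ 0ℚ)
            → (∀ k → coeff p k ≡ 0ℚ) ⊎ ∃[ d′ ] (d′ ℕ.< d × HasDegree p d′)
degreeBelow p zero    above≡0 = inj₁ (λ k → above≡0 k ℕ.z≤n)
degreeBelow p (suc d) above≡0 with coeff p d ≟ 0ℚ
... | no  pd≢0 = inj₂ (d , ℕP.≤-refl , pd≢0 , above≡0)
... | yes pd≡0 with degreeBelow p d from-d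
  where
  from-d : ∀ k → d ℕ.≤ k → coeff p k ≡ 0ℚ
  from-d k d≤k with ℕP.m≤n⇒m<n∨m≡n d≤k
  ... | inj₁ d<k  = above≡0 k d<k
  ... | inj₂ refl = pd≡0
...   | inj₁ p≡0              = inj₁ p≡0
...   | inj₂ (d′ , d′<d , hp) = inj₂ (d′ , ℕP.m<n⇒m<1+n d′<d , hp)

-- Invariants on the current pair (a , b):
-- every common divisor of a and b divides f and g, and a, b lie in the
-- ideal generated by f and g.  The sum of degrees decreases at each step,
-- and the algorithm stops with a common divisor of f and g in that ideal.

module Euclid (f g : Poly) where

  InIdeal : Poly → Set
  InIdeal p = ∃[ U ] ∃[ V ] (∀ t → eval p t ≡ eval U t * eval f t + eval V t * eval g t)

  InIdeal-step : ∀ a b c j → InIdeal a → InIdeal b → InIdeal (a ⊕ scale c (shift j b))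
  InIdeal-step a b c j (Ua , Va , a≡) (Ub , Vb , b≡) =
    Ua ⊕ scale c (shift j Ub) , Va ⊕ scale c (shift j Vb) , λ t → begin-equality
      eval (a ⊕ scale c (shift j b)) t
        ≡⟨ eval-step a b c j t ⟩
      eval a t + c * (t ^ℚ j * eval b t)
        ≡⟨ cong₂ (λ x y → x + c * (t ^ℚ j * y)) (a≡ t) (b≡ t) ⟩
      (eval Ua t * eval f t + eval Va t * eval g t) + c * (t ^ℚ j * (eval Ub t * eval f t + eval Vb t * eval g t))
        ≡⟨ ring (eval Ua t) (eval Va t) (eval Ub t) (eval Vb t) (eval f t) (eval g t) c (t ^ℚ j) ⟩
      (eval Ua t + c * (t ^ℚ j * eval Ub t)) * eval f t + (eval Va t + c * (t ^ℚ j * eval Vb t)) * eval g t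
        ≡⟨ sym (cong₂ (λ x y → x * eval f t + y * eval g t) (eval-step Ua Ub c j t) (eval-step Va Vb c j t)) ⟩
      eval (Ua ⊕ scale c (shift j Ub)) t * eval f t + eval (Va ⊕ scale c (shift j Vb)) t * eval g t ∎
    where
    ring : ∀ ua va ub vb F G c T → (ua * F + va * G) + c * (T * (ub * F + vb * G))
                                  ≡ (ua + c * (T * ub)) * F + (va + c * (T * vb)) * G
    ring = solve-∀ ℚ-ring

  Controls : Poly → Poly → Set
  Controls a b = ∀ d → d ∣ₚ a → d ∣ₚ b → d ∣ₚ f × d ∣ₚ g

  CommonDivisorInIdeal : Set
  CommonDivisorInIdeal = ∃[ d ] (d ∣ₚ f × d ∣ₚ g × InIdeal d)

  euclid : ∀ N a b da db → HasDegree a da → HasDegree b db → da ℕ.+ db ℕ.< N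
         → Controls a b → InIdeal a → InIdeal b → CommonDivisorInIdeal
  euclidOrdered : ∀ N a b da db → HasDegree a da → HasDegree b db → da ℕ.+ db ℕ.< N
                → db ℕ.≤ da → Controls a b → InIdeal a → InIdeal b → CommonDivisorInIdeal

  euclid N a b da db ha hb bound ctl ia ib with ℕP.≤-total db da
  ... | inj₁ db≤da = euclidOrdered N a b da db ha hb bound db≤da ctl ia ib
  ... | inj₂ da≤db = euclidOrdered N b a db da hb ha (subst (ℕ._< N) (ℕP.+-comm da db) bound) da≤db
                                   (λ d d∣b d∣a → ctl d d∣a d∣b) ib ia

  euclidOrdered (suc N) a b da db ha hb@(lc≢0 , _) (ℕ.s≤s bound) db≤da ctl ia ib
    with degreeBelow (reduceBy a b da db lc≢0) da (reduceBy-lowersDegree a b ha hb db≤da)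
  ... | inj₁ r≡0 = b , proj₁ b∣fg , proj₂ b∣fg , ib
    where
    b∣fg : b ∣ₚ f × b ∣ₚ g
    b∣fg = ctl b (∣ₚ-unstep a b (leadRatio a b da db lc≢0) (da ∸ db)
                            (∣ₚ-≡0 b (reduceBy a b da db lc≢0) r≡0) (∣ₚ-refl b))
                 (∣ₚ-refl b)
  ... | inj₂ (dr , dr<da , hr) =
    euclid N (reduceBy a b da db lc≢0) b dr db hr hb (ℕP.<-≤-trans (ℕP.+-monoˡ-< db dr<da) bound)
           (λ d d∣r d∣b → ctl d (∣ₚ-unstep a b (leadRatio a b da db lc≢0) (da ∸ db) d∣r d∣b) d∣b)
           (InIdeal-step a b (leadRatio a b da db lc≢0) (da ∸ db) ia ib) ib

open Euclid using (InIdeal)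

bezout-from-divisor : ∀ {f g} → CoprimePoly f g → Euclid.CommonDivisorInIdeal f g
                    → ∃[ U ] ∃[ V ] (∀ t → eval U t * eval f t + eval V t * eval g t ≡ 1ℚ)
bezout-from-divisor {f} {g} coprime (d , d∣f , d∣g , U , V , d≡) =
  scale d₀⁻¹ U , scale d₀⁻¹ V , λ t → begin-equality
    eval (scale d₀⁻¹ U) t * eval f t + eval (scale d₀⁻¹ V) t * eval g t
      ≡⟨ cong₂ (λ x y → x * eval f t + y * eval g t) (eval-scale d₀⁻¹ U t) (eval-scale d₀⁻¹ V t) ⟩
    (d₀⁻¹ * eval U t) * eval f t + (d₀⁻¹ * eval V t) * eval g t
      ≡⟨ ring d₀⁻¹ (eval U t) (eval V t) (eval f t) (eval g t) ⟩
    d₀⁻¹ * (eval U t * eval f t + eval V t * eval g t)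
      ≡⟨ cong (d₀⁻¹ *_) (sym (d≡ t)) ⟩
    d₀⁻¹ * eval d t
      ≡⟨ cong (d₀⁻¹ *_) (eval-const d t constant) ⟩
    d₀⁻¹ * coeff d 0
      ≡⟨ *-inverseˡ (coeff d 0) ⟩
    1ℚ ∎
  where
  constant : HasDegree d 0
  constant = coprime d d∣f d∣g
  instance
    d₀-nonZero : ℚ.NonZero (coeff d 0)
    d₀-nonZero = ℚ.≢-nonZero (proj₁ constant)
  d₀⁻¹ : ℚ
  d₀⁻¹ = ℚ.1/ coeff d 0
  ring : ∀ i u v x y → (i * u) * x + (i * v) * y ≡ i * (u * x + v * y)
  ring = solve-∀ ℚ-ring

bezout : ∀ {f g r s} → HasDegree f r → HasDegree g s → CoprimePoly f g
       → ∃[ U ] ∃[ V ] (∀ t → eval U t * eval f t + eval V t * eval g t ≡ 1ℚ)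
bezout {f} {g} {r} {s} hf hg coprime = bezout-from-divisor {f} {g} coprime
  (Euclid.euclid f g (suc (r ℕ.+ s)) f g r s hf hg ℕP.≤-refl (λ d d∣f d∣g → d∣f , d∣g) f-in g-in)
  where
  f-in : InIdeal f g f
  f-in = 1ℚ ∷ [] , [] , λ t → ring t (eval f t) (eval g t)
    where
    ring : ∀ t x y → x ≡ (1ℚ + t * 0ℚ) * x + 0ℚ * y
    ring = solve-∀ ℚ-ring
  g-in : InIdeal f g g
  g-in = [] , 1ℚ ∷ [] , λ t → ring t (eval f t) (eval g t)
    where
    ring : ∀ t x y → y ≡ 0ℚ * x + (1ℚ + t * 0ℚ) * y
    ring = solve-∀ ℚ-ring

absPoly : Poly → Poly
absPoly = map ∣_∣

absPoly-≥0 : ∀ p {T} → 0ℚ ≤ T → 0ℚ ≤ eval (absPoly p) T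
absPoly-≥0 []      _   = ≤-refl
absPoly-≥0 (c ∷ p) 0≤T = +-≥0 (0≤∣p∣ c) (*-≥0 0≤T (absPoly-≥0 p 0≤T))

eval-bound : ∀ p t {T} → ∣ t ∣ ≤ T → ∣ eval p t ∣ ≤ eval (absPoly p) T
eval-bound []      _ _ = ≤-refl
eval-bound (c ∷ p) t {T} t≤T = begin
  ∣ c + t * eval p t ∣         ≤⟨ ∣p+q∣≤∣p∣+∣q∣ c (t * eval p t) ⟩
  ∣ c ∣ + ∣ t * eval p t ∣     ≡⟨ cong (_+_ ∣ c ∣) (∣p*q∣≡∣p∣*∣q∣ t (eval p t)) ⟩
  ∣ c ∣ + ∣ t ∣ * ∣ eval p t ∣ ≤⟨ +-monoʳ-≤ ∣ c ∣ (*-mono-≤-≥0 (0≤∣p∣ t) (0≤∣p∣ (eval p t)) t≤T (eval-bound p t t≤T)) ⟩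
  ∣ c ∣ + T * eval (absPoly p) T ∎

one-of-two : ∀ {c x y} → 1ℚ ≤ c * x + c * y → 1ℚ ≤ (c + c) * x ⊎ 1ℚ ≤ (c + c) * y
one-of-two {c} {x} {y} 1≤sum with 1ℚ ≤? (c + c) * x | 1ℚ ≤? (c + c) * y
... | yes 1≤x | _       = inj₁ 1≤x
... | no  _   | yes 1≤y = inj₂ 1≤y
... | no  x<1 | no  y<1 = ⊥-elim (<-irrefl refl (begin-strict
  1ℚ + 1ℚ                             ≤⟨ +-mono-≤ 1≤sum 1≤sum ⟩
  (c * x + c * y) + (c * x + c * y)   ≡⟨ ring c x y ⟩
  (c + c) * x + (c + c) * y           <⟨ +-mono-< (≰⇒> x<1) (≰⇒> y<1) ⟩
  1ℚ + 1ℚ                             ∎))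
  where
  ring : ∀ c x y → (c * x + c * y) + (c * x + c * y) ≡ (c + c) * x + (c + c) * y
  ring = solve-∀ ℚ-ring

-- Polynomials satisfying a Bézout identity 1 = U(t) f(t) + V(t) g(t) are not
-- simultaneously small on a bounded set, since U and V are bounded there.
separated : ∀ {f g} U V → (∀ t → eval U t * eval f t + eval V t * eval g t ≡ 1ℚ) → ∀ T → 0ℚ ≤ T
          → ∃[ w ] (0ℚ ≤ w × (∀ t → ∣ t ∣ ≤ T → 1ℚ ≤ w * ∣ eval f t ∣ ⊎ 1ℚ ≤ w * ∣ eval g t ∣))
separated {f} {g} U V bez T 0≤T = c + c , +-≥0 0≤c 0≤c , λ t t≤T →
  let Ut = eval U t ; Vt = eval V t ; ft = eval f t ; gt = eval g t in
  one-of-two {c} {∣ ft ∣} {∣ gt ∣} (begin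
    1ℚ                              ≡⟨ cong ∣_∣ (sym (bez t)) ⟩
    ∣ Ut * ft + Vt * gt ∣           ≤⟨ ∣p+q∣≤∣p∣+∣q∣ (Ut * ft) (Vt * gt) ⟩
    ∣ Ut * ft ∣ + ∣ Vt * gt ∣       ≡⟨ cong₂ _+_ (∣p*q∣≡∣p∣*∣q∣ Ut ft) (∣p*q∣≡∣p∣*∣q∣ Vt gt) ⟩
    ∣ Ut ∣ * ∣ ft ∣ + ∣ Vt ∣ * ∣ gt ∣ ≤⟨ +-mono-≤ (*-monoʳ-≤-≥0 (0≤∣p∣ ft) (U≤c t t≤T))
                                              (*-monoʳ-≤-≥0 (0≤∣p∣ gt) (V≤c t t≤T)) ⟩
    c * ∣ ft ∣ + c * ∣ gt ∣         ∎)
  where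
  c : ℚ
  c = eval (absPoly U) T + eval (absPoly V) T
  0≤c : 0ℚ ≤ c
  0≤c = +-≥0 (absPoly-≥0 U 0≤T) (absPoly-≥0 V 0≤T)
  U≤c : ∀ t → ∣ t ∣ ≤ T → ∣ eval U t ∣ ≤ c
  U≤c t t≤T = ≤-trans (eval-bound U t t≤T) (p≤p+q (absPoly-≥0 V 0≤T))
  V≤c : ∀ t → ∣ t ∣ ≤ T → ∣ eval V t ∣ ≤ c
  V≤c t t≤T = ≤-trans (eval-bound V t t≤T) (p≤q+p (absPoly-≥0 U 0≤T))

abs-inverse : ∀ c → c ≢ 0ℚ → ∃[ i ] (0ℚ ≤ i × i * ∣ c ∣ ≡ 1ℚ)
abs-inverse c c≢0 = ℚ.1/ ∣ c ∣ , <⇒≤ (positive⁻¹ (ℚ.1/ ∣ c ∣) {{1/pos⇒pos ∣ c ∣}}) , *-inverseˡ ∣ c ∣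
  where
  instance
    ∣c∣-positive : ℚ.Positive ∣ c ∣
    ∣c∣-positive = nonNeg∧nonZero⇒pos ∣ c ∣ {{∣-∣-nonNeg c}} {{ℚ.≢-nonZero (λ ∣c∣≡0 → c≢0 (∣p∣≡0⇒p≡0 c ∣c∣≡0))}}
    ∣c∣-nonZero : ℚ.NonZero ∣ c ∣
    ∣c∣-nonZero = pos⇒nonZero ∣ c ∣

absorb : ∀ {P x y} → P ≤ x + y → y + y ≤ P → P ≤ x + x
absorb {P} {x} {y} P≤x+y y+y≤P = subst₂ _≤_ (ring P P) (ring (x + x) P) (+-monoˡ-≤ (- P) (begin
  P + P             ≤⟨ +-mono-≤ P≤x+y P≤x+y ⟩
  (x + y) + (x + y) ≡⟨ ring′ x y ⟩
  (x + x) + (y + y) ≤⟨ +-monoʳ-≤ (x + x) y+y≤P ⟩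
  (x + x) + P       ∎))
  where
  ring : ∀ a P → a + P + - P ≡ a
  ring = solve-∀ ℚ-ring
  ring′ : ∀ x y → (x + y) + (x + y) ≡ (x + x) + (y + y)
  ring′ = solve-∀ ℚ-ring

leadingTermDominates : ∀ p d → HasDegree p d
  → ∃[ T ] ∃[ κ ] (1ℚ ≤ T × 0ℚ ≤ κ × (∀ t → T ≤ ∣ t ∣ → ∣ t ∣ ^ℚ d ≤ κ * ∣ eval p t ∣))
leadingTermDominates [] d (lc≢0 , _) = ⊥-elim (lc≢0 refl)
leadingTermDominates (c ∷ p) zero hp@(c≢0 , _) with abs-inverse c c≢0
... | i , 0≤i , i*c≡1 = 1ℚ , i , ≤-refl , 0≤i , λ t _ → ≤-reflexive (begin-equality
  1ℚ                     ≡⟨ sym i*c≡1 ⟩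
  i * ∣ c ∣              ≡⟨ cong (λ z → i * ∣ z ∣) (sym (eval-const (c ∷ p) t hp)) ⟩
  i * ∣ eval (c ∷ p) t ∣ ∎)
leadingTermDominates (c ∷ p) (suc d) (lc≢0 , higher)
  with leadingTermDominates p d (lc≢0 , λ k d<k → higher (suc k) (ℕ.s≤s d<k))
... | T , κ , 1≤T , 0≤κ , dominates =
  T + (κ + κ) * ∣ c ∣ , κ + κ , ≤-trans 1≤T (p≤p+q 0≤2κc) , +-≥0 0≤κ 0≤κ ,
  λ t T′≤t → subst (∣ t ∣ ^ℚ suc d ≤_) (sym (*-distribʳ-+ ∣ eval (c ∷ p) t ∣ κ κ))
                   (absorb {x = κ * ∣ eval (c ∷ p) t ∣} {y = κ * ∣ c ∣} (upper t T′≤t) (lower t T′≤t))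
  where
  0≤2κc : 0ℚ ≤ (κ + κ) * ∣ c ∣
  0≤2κc = *-≥0 (+-≥0 0≤κ 0≤κ) (0≤∣p∣ c)
  T≤ : ∀ {x} → T + (κ + κ) * ∣ c ∣ ≤ x → T ≤ x
  T≤ = ≤-trans (p≤p+q 0≤2κc)
  upper : ∀ t → T + (κ + κ) * ∣ c ∣ ≤ ∣ t ∣
        → ∣ t ∣ ^ℚ suc d ≤ κ * ∣ eval (c ∷ p) t ∣ + κ * ∣ c ∣
  upper t T′≤t = begin
    ∣ t ∣ * ∣ t ∣ ^ℚ d                     ≤⟨ *-monoˡ-≤-≥0 (0≤∣p∣ t) (dominates t (T≤ T′≤t)) ⟩
    ∣ t ∣ * (κ * ∣ eval p t ∣)             ≡⟨ ring (∣ t ∣) κ (∣ eval p t ∣) ⟩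
    κ * (∣ t ∣ * ∣ eval p t ∣)             ≡⟨ cong (κ *_) (sym (∣p*q∣≡∣p∣*∣q∣ t (eval p t))) ⟩
    κ * ∣ t * eval p t ∣                   ≡⟨ cong (λ z → κ * ∣ z ∣) (ring′ c (t * eval p t)) ⟩
    κ * ∣ eval (c ∷ p) t - c ∣             ≤⟨ *-monoˡ-≤-≥0 0≤κ (∣p-q∣≤∣p∣+∣q∣ (eval (c ∷ p) t) c) ⟩
    κ * (∣ eval (c ∷ p) t ∣ + ∣ c ∣)       ≡⟨ *-distribˡ-+ κ _ _ ⟩
    κ * ∣ eval (c ∷ p) t ∣ + κ * ∣ c ∣     ∎
    where
    ring : ∀ a k e → a * (k * e) ≡ k * (a * e)
    ring = solve-∀ ℚ-ring
    ring′ : ∀ c x → x ≡ c + x - c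
    ring′ = solve-∀ ℚ-ring
  lower : ∀ t → T + (κ + κ) * ∣ c ∣ ≤ ∣ t ∣ → κ * ∣ c ∣ + κ * ∣ c ∣ ≤ ∣ t ∣ ^ℚ suc d
  lower t T′≤t = begin
    κ * ∣ c ∣ + κ * ∣ c ∣ ≡⟨ sym (*-distribʳ-+ ∣ c ∣ κ κ) ⟩
    (κ + κ) * ∣ c ∣       ≤⟨ p≤q+p (≤-trans 0≤1 1≤T) ⟩
    T + (κ + κ) * ∣ c ∣   ≤⟨ T′≤t ⟩
    ∣ t ∣                 ≤⟨ p≤p^k (suc d) (ℕ.s≤s ℕ.z≤n) (≤-trans 1≤T (T≤ T′≤t)) ⟩
    ∣ t ∣ ^ℚ suc d        ∎

inverseBound : ∀ Q → All (λ q → q ≢ 0ℚ) Q → ∃[ ι ] (0ℚ ≤ ι × (∀ {q} → q ∈ Q → 1ℚ ≤ ι * ∣ q ∣))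
inverseBound []      []          = 0ℚ , ≤-refl , λ ()
inverseBound (q ∷ Q) (q≢0 ∷ Q≢0) with abs-inverse q q≢0 | inverseBound Q Q≢0
... | i , 0≤i , i*∣q∣≡1 | ι , 0≤ι , ι-bound = i + ι , +-≥0 0≤i 0≤ι , λ where
  (here refl)      → begin
    1ℚ              ≡⟨ sym i*∣q∣≡1 ⟩
    i * ∣ q ∣       ≤⟨ *-monoʳ-≤-≥0 (0≤∣p∣ q) (p≤p+q {i} 0≤ι) ⟩
    (i + ι) * ∣ q ∣ ∎
  {q′} (there q′∈Q) → ≤-trans (ι-bound q′∈Q) (*-monoʳ-≤-≥0 (0≤∣p∣ q′) (p≤q+p {ι} 0≤i))

abs-scaled : ∀ x b k → ∣ x * ℤ→ℚ (+ (b ℕ.^ k)) ∣ ≡ ∣ x ∣ * ℤ→ℚ (+ b) ^ℚ k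
abs-scaled x b k = trans (∣p*q∣≡∣p∣*∣q∣ x (ℤ→ℚ (+ (b ℕ.^ k))))
                         (cong (∣ x ∣ *_) (trans (∣ℤ→ℚ∣ (+ (b ℕ.^ k))) (ℤ→ℚ-^ b k)))

≤-scaled : ∀ {ι x} y → 0ℚ ≤ y → 1ℚ ≤ ι * x → y ≤ ι * (x * y)
≤-scaled {ι} {x} y 0≤y 1≤ιx = begin
  y          ≡⟨ sym (*-identityˡ y) ⟩
  1ℚ * y     ≤⟨ *-monoʳ-≤-≥0 0≤y 1≤ιx ⟩
  ι * x * y  ≡⟨ *-assoc ι x y ⟩
  ι * (x * y) ∎

weighted-< : ∀ {X} u v k e A → u ^ℚ k * v ≡ ℤ→ℚ A → ℤ→ℚ (+ (ℤ.∣ A ∣ ℕ.^ e)) < X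
           → (∣ u ∣ ^ℚ k * ∣ v ∣) ^ℚ e < X
weighted-< {X} u v k e A uᵏv≡A Aᵉ<X =
  subst (_< X) (trans (ℤ→ℚ-^ ℤ.∣ A ∣ e) (cong (_^ℚ e) ∣A∣≡)) Aᵉ<X
  where
  ∣A∣≡ : ℤ→ℚ (+ ℤ.∣ A ∣) ≡ ∣ u ∣ ^ℚ k * ∣ v ∣
  ∣A∣≡ = begin-equality
    ℤ→ℚ (+ ℤ.∣ A ∣)    ≡⟨ sym (∣ℤ→ℚ∣ A) ⟩
    ∣ ℤ→ℚ A ∣          ≡⟨ cong ∣_∣ (sym uᵏv≡A) ⟩
    ∣ u ^ℚ k * v ∣     ≡⟨ ∣p*q∣≡∣p∣*∣q∣ (u ^ℚ k) v ⟩
    ∣ u ^ℚ k ∣ * ∣ v ∣ ≡⟨ cong (_* ∣ v ∣) (^ℚ-abs u k) ⟩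
    ∣ u ∣ ^ℚ k * ∣ v ∣ ∎

S₁-f : ∀ {f g} X u t → InS₁ f g X u t → (∣ u ∣ ^ℚ 4 * ∣ eval f t ∣) ^ℚ 3 < X
S₁-f {f} X u t (A , _ , u⁴f≡A , _ , _ , _ , A³<X , _) = weighted-< u (eval f t) 4 3 A u⁴f≡A A³<X

S₁-g : ∀ {f g} X u t → InS₁ f g X u t → (∣ u ∣ ^ℚ 6 * ∣ eval g t ∣) ^ℚ 2 < X
S₁-g {g = g} X u t (_ , B , _ , u⁶g≡B , _ , _ , _ , B²<X) = weighted-< u (eval g t) 6 2 B u⁶g≡B B²<X

-- The polynomial realising max(r/4, s/6) = n/m: either f with weight k = 4
-- or g with weight k = 6, of degree d with d/k = n/m, and with k·e = 12.
record Dominant (f g : Poly) (n m : ℕ) : Set where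
  field
    p       : Poly
    k e d   : ℕ
    k*e≡12  : k ℕ.* e ≡ 12
    d*m≡k*n : d ℕ.* m ≡ k ℕ.* n
    p-degree   : HasDegree p d
    p-weighted : ∀ X u t → InS₁ f g X u t → (∣ u ∣ ^ℚ k * ∣ eval p t ∣) ^ℚ e < X

cancel-24 : ∀ a k x m n .{{_ : ℕ.NonZero a}} → a ℕ.* k ≡ 24 → (a ℕ.* x) ℕ.* m ≡ 24 ℕ.* n
          → x ℕ.* m ≡ k ℕ.* n
cancel-24 a k x m n a*k≡24 eq = ℕP.*-cancelˡ-≡ (x ℕ.* m) (k ℕ.* n) a
  (trans (sym (ℕP.*-assoc a x m))
  (trans eq
  (trans (cong (ℕ._* n) (sym a*k≡24))
         (ℕP.*-assoc a k n))))

dominant : ∀ {f g r s n m} → HasDegree f r → HasDegree g s → (6 ℕ.* r ⊔ 4 ℕ.* s) ℕ.* m ≡ 24 ℕ.* n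
         → Dominant f g n m
dominant {f} {g} {r} {s} {n} {m} hf hg max≡ with ℕP.≤-total (6 ℕ.* r) (4 ℕ.* s)
... | inj₁ 6r≤4s = record
  { p = g ; k = 6 ; e = 2 ; d = s ; k*e≡12 = refl
  ; d*m≡k*n = cancel-24 4 6 s m n refl (trans (cong (ℕ._* m) (sym (ℕP.m≤n⇒m⊔n≡n 6r≤4s))) max≡)
  ; p-degree = hg ; p-weighted = S₁-g {f} {g} }
... | inj₂ 4s≤6r = record
  { p = f ; k = 4 ; e = 3 ; d = r ; k*e≡12 = refl
  ; d*m≡k*n = cancel-24 6 4 r m n refl (trans (cong (ℕ._* m) (sym (ℕP.m≥n⇒m⊔n≡m 4s≤6r))) max≡)
  ; p-degree = hf ; p-weighted = S₁-f {f} {g} }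

^ℚ-nest : ∀ x i j l → ((x ^ℚ i) ^ℚ j) ^ℚ l ≡ x ^ℚ (i ℕ.* j ℕ.* l)
^ℚ-nest x i j l =
  trans (^ℚ-assoc (x ^ℚ i) j l) (trans (^ℚ-assoc x i (j ℕ.* l)) (cong (x ^ℚ_) (sym (ℕP.*-assoc i j l))))

^ℚ-swap : ∀ x i j → (x ^ℚ i) ^ℚ j ≡ (x ^ℚ j) ^ℚ i
^ℚ-swap x i j = trans (^ℚ-assoc x i j) (trans (cong (x ^ℚ_) (ℕP.*-comm i j)) (sym (^ℚ-assoc x j i)))

12n≡n·k·e : ∀ n k e → k ℕ.* e ≡ 12 → 12 ℕ.* n ≡ n ℕ.* k ℕ.* e
12n≡n·k·e n k e k*e≡12 = trans (cong (ℕ._* n) (sym k*e≡12)) (ring n k e)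
  where
  ring : ∀ n k e → k ℕ.* e ℕ.* n ≡ n ℕ.* k ℕ.* e
  ring = ℕ-Solver.solve-∀

12n≡d·e·m : ∀ n m k e d → k ℕ.* e ≡ 12 → d ℕ.* m ≡ k ℕ.* n → 12 ℕ.* n ≡ d ℕ.* e ℕ.* m
12n≡d·e·m n m k e d k*e≡12 d*m≡k*n =
  trans (12n≡n·k·e n k e k*e≡12)
  (trans (ring n k e)
  (trans (cong (ℕ._* e) (sym d*m≡k*n))
         (ring′ d m e)))
  where
  ring : ∀ n k e → n ℕ.* k ℕ.* e ≡ k ℕ.* n ℕ.* e
  ring = ℕ-Solver.solve-∀
  ring′ : ∀ d m e → d ℕ.* m ℕ.* e ≡ d ℕ.* e ℕ.* m
  ring′ = ℕ-Solver.solve-∀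

-- Pointwise height estimates.  Throughout β stands for b, au for |u|, at
-- for |t| and P for |p(t)|; the weighted value au^k·P has its e-th power
-- below X.

power-bound : ∀ {y c z X} e → 0ℚ ≤ y → 0ℚ ≤ c → 0ℚ ≤ z → y ≤ c * z → z ^ℚ e < X → y ^ℚ e ≤ c ^ℚ e * X
power-bound {y} {c} {z} {X} e 0≤y 0≤c 0≤z y≤cz zᵉ<X = begin
  y ^ℚ e            ≤⟨ ^ℚ-mono-≤ e 0≤y y≤cz ⟩
  (c * z) ^ℚ e      ≡⟨ ^ℚ-distrib-* c z e ⟩
  c ^ℚ e * z ^ℚ e   ≤⟨ *-monoˡ-≤-≥0 (^ℚ-≥0 e 0≤c) (<⇒≤ zᵉ<X) ⟩
  c ^ℚ e * X        ∎

denominator-weighted : ∀ {β au ι w P} k → 0ℚ ≤ β → 0ℚ ≤ au → 0ℚ ≤ ι → β ≤ ι * au → 1ℚ ≤ w * P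
                     → β ^ℚ k ≤ (ι ^ℚ k * w) * (au ^ℚ k * P)
denominator-weighted {β} {au} {ι} {w} {P} k 0≤β 0≤au 0≤ι β≤ιau 1≤wP = begin
  β ^ℚ k                         ≤⟨ ^ℚ-mono-≤ k 0≤β β≤ιau ⟩
  (ι * au) ^ℚ k                  ≡⟨ trans (^ℚ-distrib-* ι au k) (sym (*-identityʳ _)) ⟩
  ι ^ℚ k * au ^ℚ k * 1ℚ          ≤⟨ *-monoˡ-≤-≥0 (*-≥0 (^ℚ-≥0 k 0≤ι) (^ℚ-≥0 k 0≤au)) 1≤wP ⟩
  ι ^ℚ k * au ^ℚ k * (w * P)     ≡⟨ ring (ι ^ℚ k) (au ^ℚ k) w P ⟩
  (ι ^ℚ k * w) * (au ^ℚ k * P)   ∎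
  where
  ring : ∀ i a w P → i * a * (w * P) ≡ (i * w) * (a * P)
  ring = solve-∀ ℚ-ring

numerator-weighted : ∀ {β au ι κ P at} n m k d → d ℕ.* m ≡ k ℕ.* n → 0ℚ ≤ β → 0ℚ ≤ at
                   → β ^ℚ n ≤ ι * au → at ^ℚ d ≤ κ * P
                   → (at * β ^ℚ m) ^ℚ d ≤ (ι ^ℚ k * κ) * (au ^ℚ k * P)
numerator-weighted {β} {au} {ι} {κ} {P} {at} n m k d d*m≡k*n 0≤β 0≤at βⁿ≤ιau atᵈ≤κP = begin
  (at * β ^ℚ m) ^ℚ d              ≡⟨ ^ℚ-distrib-* at (β ^ℚ m) d ⟩
  at ^ℚ d * (β ^ℚ m) ^ℚ d         ≡⟨ cong (at ^ℚ d *_) βᵐᵈ≡βⁿᵏ ⟩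
  at ^ℚ d * (β ^ℚ n) ^ℚ k         ≤⟨ *-mono-≤-≥0 (^ℚ-≥0 d 0≤at) (^ℚ-≥0 k (^ℚ-≥0 n 0≤β))
                                                 atᵈ≤κP (^ℚ-mono-≤ k (^ℚ-≥0 n 0≤β) βⁿ≤ιau) ⟩
  κ * P * (ι * au) ^ℚ k           ≡⟨ cong (κ * P *_) (^ℚ-distrib-* ι au k) ⟩
  κ * P * (ι ^ℚ k * au ^ℚ k)      ≡⟨ ring κ P (ι ^ℚ k) (au ^ℚ k) ⟩
  (ι ^ℚ k * κ) * (au ^ℚ k * P)    ∎
  where
  ring : ∀ κ P i a → κ * P * (i * a) ≡ (i * κ) * (a * P)
  ring = solve-∀ ℚ-ring
  βᵐᵈ≡βⁿᵏ : (β ^ℚ m) ^ℚ d ≡ (β ^ℚ n) ^ℚ k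
  βᵐᵈ≡βⁿᵏ = trans (^ℚ-assoc β m d)
              (trans (cong (β ^ℚ_) (trans (ℕP.*-comm m d) (trans d*m≡k*n (ℕP.*-comm k n))))
                     (sym (^ℚ-assoc β n k)))

denominator-bound : ∀ {β au ι w P X} n k e → k ℕ.* e ≡ 12
                  → 0ℚ ≤ β → 0ℚ ≤ au → 0ℚ ≤ ι → 0ℚ ≤ w → 0ℚ ≤ P
                  → β ^ℚ n ≤ ι * au → 1ℚ ≤ w * P → (au ^ℚ k * P) ^ℚ e < X
                  → β ^ℚ (12 ℕ.* n) ≤ (ι ^ℚ k * w) ^ℚ e * X
denominator-bound {β} n k e k*e≡12 0≤β 0≤au 0≤ι 0≤w 0≤P βⁿ≤ιau 1≤wP weighted =
  subst (_≤ _) (trans (^ℚ-nest β n k e) (cong (β ^ℚ_) (sym (12n≡n·k·e n k e k*e≡12))))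
        (power-bound e (^ℚ-≥0 k (^ℚ-≥0 n 0≤β)) (*-≥0 (^ℚ-≥0 k 0≤ι) 0≤w) (*-≥0 (^ℚ-≥0 k 0≤au) 0≤P)
                     (denominator-weighted k (^ℚ-≥0 n 0≤β) 0≤au 0≤ι βⁿ≤ιau 1≤wP) weighted)

numerator-bound : ∀ {β au ι κ P at X} n m k e d → k ℕ.* e ≡ 12 → d ℕ.* m ≡ k ℕ.* n
                → 0ℚ ≤ β → 0ℚ ≤ au → 0ℚ ≤ ι → 0ℚ ≤ κ → 0ℚ ≤ P → 0ℚ ≤ at
                → β ^ℚ n ≤ ι * au → at ^ℚ d ≤ κ * P → (au ^ℚ k * P) ^ℚ e < X
                → (at * β ^ℚ m) ^ℚ (12 ℕ.* n) ≤ ((ι ^ℚ k * κ) ^ℚ e) ^ℚ m * X ^ℚ m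
numerator-bound {β} {au} {ι} {κ} {P} {at} {X} n m k e d k*e≡12 d*m≡k*n 0≤β 0≤au 0≤ι 0≤κ 0≤P 0≤at
                βⁿ≤ιau atᵈ≤κP weighted = begin
  α ^ℚ (12 ℕ.* n)             ≡⟨ cong (α ^ℚ_) (12n≡d·e·m n m k e d k*e≡12 d*m≡k*n) ⟩
  α ^ℚ (d ℕ.* e ℕ.* m)        ≡⟨ sym (^ℚ-nest α d e m) ⟩
  ((α ^ℚ d) ^ℚ e) ^ℚ m        ≤⟨ ^ℚ-mono-≤ m (^ℚ-≥0 e (^ℚ-≥0 d 0≤α)) αᵈᵉ-bound ⟩
  (c ^ℚ e * X) ^ℚ m           ≡⟨ ^ℚ-distrib-* (c ^ℚ e) X m ⟩
  (c ^ℚ e) ^ℚ m * X ^ℚ m      ∎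
  where
  α = at * β ^ℚ m
  c = ι ^ℚ k * κ
  0≤α : 0ℚ ≤ α
  0≤α = *-≥0 0≤at (^ℚ-≥0 m 0≤β)
  αᵈᵉ-bound : (α ^ℚ d) ^ℚ e ≤ c ^ℚ e * X
  αᵈᵉ-bound = power-bound e (^ℚ-≥0 d 0≤α) (*-≥0 (^ℚ-≥0 k 0≤ι) 0≤κ) (*-≥0 (^ℚ-≥0 k 0≤au) 0≤P)
                          (numerator-weighted n m k d d*m≡k*n 0≤β 0≤at βⁿ≤ιau atᵈ≤κP) weighted

record HeightBounds (C : ℚ) (n m : ℕ) (X α β : ℚ) : Set where
  constructor heights
  field
    numerator   : α ^ℚ (12 ℕ.* n) ≤ C * X ^ℚ m
    denominator : β ^ℚ (12 ℕ.* n) ≤ C * X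

HeightBounds-mono : ∀ {C C′ n m X α β} → 0ℚ ≤ X → C ≤ C′
                  → HeightBounds C n m X α β → HeightBounds C′ n m X α β
HeightBounds-mono {m = m} 0≤X C≤C′ (heights α-bound β-bound) =
  heights (≤-trans α-bound (*-monoʳ-≤-≥0 (^ℚ-≥0 m 0≤X) C≤C′)) (≤-trans β-bound (*-monoʳ-≤-≥0 0≤X C≤C′))

heights-near : ∀ {n m X β at c T} → 0ℚ ≤ X → 0ℚ ≤ β → 0ℚ ≤ at → 0ℚ ≤ c → at ≤ T
             → β ^ℚ (12 ℕ.* n) ≤ c * X
             → HeightBounds (T ^ℚ (12 ℕ.* n) * c ^ℚ m ℚ.⊔ c) n m X (at * β ^ℚ m) β
heights-near {n} {m} {X} {β} {at} {c} {T} 0≤X 0≤β 0≤at 0≤c at≤T β-bound =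
  heights (≤-trans α-bound (*-monoʳ-≤-≥0 (^ℚ-≥0 m 0≤X) (p≤p⊔q (T ^ℚ N * c ^ℚ m) c)))
          (≤-trans β-bound (*-monoʳ-≤-≥0 0≤X (p≤q⊔p (T ^ℚ N * c ^ℚ m) c)))
  where
  N = 12 ℕ.* n
  α-bound : (at * β ^ℚ m) ^ℚ N ≤ T ^ℚ N * c ^ℚ m * X ^ℚ m
  α-bound = begin
    (at * β ^ℚ m) ^ℚ N            ≡⟨ ^ℚ-distrib-* at (β ^ℚ m) N ⟩
    at ^ℚ N * (β ^ℚ m) ^ℚ N       ≡⟨ cong (at ^ℚ N *_) (^ℚ-swap β m N) ⟩
    at ^ℚ N * (β ^ℚ N) ^ℚ m       ≤⟨ *-mono-≤-≥0 (^ℚ-≥0 N 0≤at) (^ℚ-≥0 m (^ℚ-≥0 N 0≤β))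
                                       (^ℚ-mono-≤ N 0≤at at≤T) (^ℚ-mono-≤ m (^ℚ-≥0 N 0≤β) β-bound) ⟩
    T ^ℚ N * (c * X) ^ℚ m         ≡⟨ cong (T ^ℚ N *_) (^ℚ-distrib-* c X m) ⟩
    T ^ℚ N * (c ^ℚ m * X ^ℚ m)    ≡⟨ sym (*-assoc (T ^ℚ N) (c ^ℚ m) (X ^ℚ m)) ⟩
    T ^ℚ N * c ^ℚ m * X ^ℚ m      ∎

-- Far from 0 (1 ≤ at) the denominator is controlled by the numerator,
-- since then βᵐ ≤ at·βᵐ.
heights-far : ∀ {n m X β at c} → 0 ℕ.< m → 0ℚ ≤ X → 0ℚ ≤ β → 0ℚ ≤ c → 1ℚ ≤ at
            → (at * β ^ℚ m) ^ℚ (12 ℕ.* n) ≤ c * X ^ℚ m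
            → HeightBounds (1ℚ + c) n m X (at * β ^ℚ m) β
heights-far {n} {m} {X} {β} {at} {c} 0<m 0≤X 0≤β 0≤c 1≤at α-bound =
  heights (≤-trans α-bound (*-monoʳ-≤-≥0 (^ℚ-≥0 m 0≤X) c≤1+c))
  (^ℚ-cancel-≤ m 0<m (*-≥0 (+-≥0 0≤1 0≤c) 0≤X) (begin
    (β ^ℚ N) ^ℚ m              ≡⟨ ^ℚ-swap β N m ⟩
    (β ^ℚ m) ^ℚ N              ≤⟨ ^ℚ-mono-≤ N (^ℚ-≥0 m 0≤β) βᵐ≤α ⟩
    (at * β ^ℚ m) ^ℚ N         ≤⟨ α-bound ⟩
    c * X ^ℚ m                 ≤⟨ *-monoʳ-≤-≥0 (^ℚ-≥0 m 0≤X) (≤-trans c≤1+c (p≤p^k m 0<m (p≤p+q 0≤c))) ⟩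
    (1ℚ + c) ^ℚ m * X ^ℚ m     ≡⟨ sym (^ℚ-distrib-* (1ℚ + c) X m) ⟩
    ((1ℚ + c) * X) ^ℚ m        ∎))
  where
  N = 12 ℕ.* n
  c≤1+c : c ≤ 1ℚ + c
  c≤1+c = p≤q+p 0≤1
  βᵐ≤α : β ^ℚ m ≤ at * β ^ℚ m
  βᵐ≤α = subst (_≤ at * β ^ℚ m) (*-identityˡ _) (*-monoʳ-≤-≥0 (^ℚ-≥0 m 0≤β) 1≤at)

-- Once the constants ι (for Q), T and κ (for the leading term of the
-- dominant polynomial) and w (for the separation of f and g near 0) are
-- fixed, the heights of all points of S₁(X) are bounded with one constant:
-- split according to |t| ≤ T or T ≤ |t|.
heightBounds : ∀ {f g n m Q ι T κ w} → 0 ℕ.< m → (D : Dominant f g n m)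
  → 0ℚ ≤ ι → (∀ {q} → q ∈ Q → 1ℚ ≤ ι * ∣ q ∣)
  → 1ℚ ≤ T → 0ℚ ≤ κ → (∀ t → T ≤ ∣ t ∣ → ∣ t ∣ ^ℚ Dominant.d D ≤ κ * ∣ eval (Dominant.p D) t ∣)
  → 0ℚ ≤ w → (∀ t → ∣ t ∣ ≤ T → 1ℚ ≤ w * ∣ eval f t ∣ ⊎ 1ℚ ≤ w * ∣ eval g t ∣)
  → ∃[ C ] (0ℚ ≤ C × (∀ X → 1ℚ ≤ X → ∀ u t → InS₁ f g X u t → ∀ a b q → Rep Q n m u t a b q
                        → HeightBounds C n m X ∣ ℤ→ℚ a ∣ (ℤ→ℚ (+ b))))
heightBounds {f} {g} {n} {m} {Q} {ι} {T} {κ} {w} 0<m D 0≤ι ι-bound 1≤T 0≤κ dominates 0≤w sep =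
  C-near ℚ.⊔ C-far , ≤-trans 0≤C-far (p≤q⊔p C-near C-far) , bounds
  where
  open Dominant D
  c-f c-g c-near c-far C-near C-far : ℚ
  c-f    = (ι ^ℚ 4 * w) ^ℚ 3
  c-g    = (ι ^ℚ 6 * w) ^ℚ 2
  c-near = c-f ℚ.⊔ c-g
  C-near = T ^ℚ (12 ℕ.* n) * c-near ^ℚ m ℚ.⊔ c-near
  c-far  = ((ι ^ℚ k * κ) ^ℚ e) ^ℚ m
  C-far  = 1ℚ + c-far
  0≤c-near : 0ℚ ≤ c-near
  0≤c-near = ≤-trans (^ℚ-≥0 3 (*-≥0 (^ℚ-≥0 4 0≤ι) 0≤w)) (p≤p⊔q c-f c-g)
  0≤c-far : 0ℚ ≤ c-far
  0≤c-far = ^ℚ-≥0 m (^ℚ-≥0 e (*-≥0 (^ℚ-≥0 k 0≤ι) 0≤κ))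
  0≤C-far : 0ℚ ≤ C-far
  0≤C-far = +-≥0 0≤1 0≤c-far
  bounds : ∀ X → 1ℚ ≤ X → ∀ u t → InS₁ f g X u t → ∀ a b q → Rep Q n m u t a b q
         → HeightBounds (C-near ℚ.⊔ C-far) n m X ∣ ℤ→ℚ a ∣ (ℤ→ℚ (+ b))
  bounds X 1≤X u t inS₁ a b q (_ , tbᵐ≡a , u≡qbⁿ , _ , q∈Q) =
    subst (λ α → HeightBounds (C-near ℚ.⊔ C-far) n m X α β) (sym ∣a∣≡∣t∣βᵐ) (by-size (≤-total ∣ t ∣ T))
    where
    β = ℤ→ℚ (+ b)
    0≤X : 0ℚ ≤ X
    0≤X = ≤-trans 0≤1 1≤X
    0≤β : 0ℚ ≤ β
    0≤β = ℤ→ℚ-≥0 b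
    ∣a∣≡∣t∣βᵐ : ∣ ℤ→ℚ a ∣ ≡ ∣ t ∣ * β ^ℚ m
    ∣a∣≡∣t∣βᵐ = trans (cong ∣_∣ (sym tbᵐ≡a)) (abs-scaled t b m)
    βⁿ≤ι∣u∣ : β ^ℚ n ≤ ι * ∣ u ∣
    βⁿ≤ι∣u∣ = subst (β ^ℚ n ≤_) (cong (ι *_) (sym (trans (cong ∣_∣ u≡qbⁿ) (abs-scaled q b n))))
                    (≤-scaled {ι} {∣ q ∣} (β ^ℚ n) (^ℚ-≥0 n 0≤β) (ι-bound q∈Q))
    denominator-near : ∣ t ∣ ≤ T → β ^ℚ (12 ℕ.* n) ≤ c-near * X
    denominator-near t≤T with sep t t≤T
    ... | inj₁ 1≤w∣f∣ = ≤-trans (denominator-bound n 4 3 refl 0≤β (0≤∣p∣ u) 0≤ι 0≤w (0≤∣p∣ (eval f t))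
                                                   βⁿ≤ι∣u∣ 1≤w∣f∣ (S₁-f {f} {g} X u t inS₁))
                                (*-monoʳ-≤-≥0 0≤X (p≤p⊔q c-f c-g))
    ... | inj₂ 1≤w∣g∣ = ≤-trans (denominator-bound n 6 2 refl 0≤β (0≤∣p∣ u) 0≤ι 0≤w (0≤∣p∣ (eval g t))
                                                   βⁿ≤ι∣u∣ 1≤w∣g∣ (S₁-g {f} {g} X u t inS₁))
                                (*-monoʳ-≤-≥0 0≤X (p≤q⊔p c-f c-g))
    by-size : ∣ t ∣ ≤ T ⊎ T ≤ ∣ t ∣ → HeightBounds (C-near ℚ.⊔ C-far) n m X (∣ t ∣ * β ^ℚ m) β
    by-size (inj₁ t≤T) = HeightBounds-mono 0≤X (p≤p⊔q C-near C-far)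
      (heights-near 0≤X 0≤β (0≤∣p∣ t) 0≤c-near t≤T (denominator-near t≤T))
    by-size (inj₂ T≤t) = HeightBounds-mono 0≤X (p≤q⊔p C-near C-far)
      (heights-far 0<m 0≤X 0≤β 0≤c-far (≤-trans 1≤T T≤t)
        (numerator-bound n m k e d k*e≡12 d*m≡k*n 0≤β (0≤∣p∣ u) 0≤ι 0≤κ (0≤∣p∣ (eval p t)) (0≤∣p∣ t)
                         βⁿ≤ι∣u∣ (dominates t T≤t) (p-weighted X u t inS₁)))

rootBounds : ∀ {C n m X α β} → 0 ℕ.< n → 0ℚ ≤ C → 0ℚ ≤ X → HeightBounds C n m X α β
           → LeRootBound α (1ℚ + C) X m (12 ℕ.* n) × LeRootBound β (1ℚ + C) X 1 (12 ℕ.* n)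
rootBounds {C} {n} {m} {X} 0<n 0≤C 0≤X bounds =
  let heights α-bound β-bound = HeightBounds-mono 0≤X C≤Kᴺ bounds
  in  α-bound , subst (_ ≤_) (cong (K ^ℚ N *_) (sym (*-identityʳ X))) β-bound
  where
  N = 12 ℕ.* n
  K = 1ℚ + C
  C≤Kᴺ : C ≤ K ^ℚ N
  C≤Kᴺ = ≤-trans (p≤q+p 0≤1) (p≤p^k N (ℕP.<-≤-trans (ℕ.s≤s ℕ.z≤n) (ℕP.*-monoʳ-≤ 12 0<n)) (p≤p+q 0≤C))

lemma2p5 : (f g : Poly) (r s : ℕ) → HasDegree f r → HasDegree g s → CoprimePoly f g
    → (0 ℕ.< r ⊎ 0 ℕ.< s)
    → (n m : ℕ) → 0 ℕ.< n → 0 ℕ.< m → Coprime n m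
    → (6 ℕ.* r ⊔ 4 ℕ.* s) ℕ.* m ≡ 24 ℕ.* n
    → (n ≡ 1 ⊎ m ≡ 1)
    → (Q : List ℚ) → All (λ q → q ≢ 0ℚ) Q
    → (∀ (X : ℚ) → 1ℚ ℚ.≤ X → ∀ u t → InS₁ f g X u t
         → ∃[ a ] ∃[ b ] ∃[ q ] Rep Q n m u t a b q)
    → ∃[ K ] ∃[ K′ ] (0ℚ ℚ.< K × 0ℚ ℚ.< K′
         × (∀ (X : ℚ) → 1ℚ ℚ.≤ X → ∀ u t → InS₁ f g X u t
              → ∀ a b q → Rep Q n m u t a b q
              → LeRootBound (ℚ.∣ ℤ→ℚ a ∣) K X m (12 ℕ.* n)
                × LeRootBound (ℤ→ℚ (+ b)) K′ X 1 (12 ℕ.* n)))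
-- Fix the constants ι, T, κ and w of the auxiliary lemmas, bound the heights
-- with a common constant C and take K = K′ = 1 + C.
lemma2p5 f g r s hf hg coprime _ n m 0<n 0<m _ max≡ _ Q Q≢0 _ =
  let (ι , 0≤ι , ι-bound)             = inverseBound Q Q≢0
      D                               = dominant {f} {g} {r} {s} {n} {m} hf hg max≡
      (T , κ , 1≤T , 0≤κ , dominates) = leadingTermDominates (Dominant.p D) (Dominant.d D) (Dominant.p-degree D)
      (U , V , bez)                   = bezout {f} {g} {r} {s} hf hg coprime
      (w , 0≤w , sep)                 = separated {f} {g} U V bez T (≤-trans 0≤1 1≤T)
      (C , 0≤C , bounded)             = heightBounds 0<m D 0≤ι ι-bound 1≤T 0≤κ dominates 0≤w sep
      0<K                             = <-≤-trans (positive⁻¹ 1ℚ) (p≤p+q 0≤C)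
  in  1ℚ + C , 1ℚ + C , 0<K , 0<K , λ X 1≤X u t inS₁ a b q rep →
        rootBounds 0<n 0≤C (≤-trans 0≤1 1≤X) (bounded X 1≤X u t inS₁ a b q rep)
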